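{- Let $F_1,\ldots,F_m$ be subsets of $[n]$, all of cardinality $d$, and let $\Delta$ be the simplicial complex they generate. Let $f(X_1,\ldots,X_n,Y_1,\ldots,Y_m)=\sum_{i=1}^mY_i\prod_{j\in F_i}X_j$ (over $\mathbb{Q}$). Then a basis of the linear space $\partial^+f$ consists of the following $2|\Delta|$ polynomials: (i) the $|\Delta|$ monomials $\prod_{j\in F}X_j$ for $F$ a face of $\Delta$; (ii) the $|\Delta|$ polynomials $\partial f/\partial F$ for $F$ a face of $\Delta$. In particular $\dim\partial^+f=2|\Delta|$.
   Context: The simplicial complex generated by $F_1,\ldots,F_m$ is the family $\Delta$ of all nonempty $Y\subseteq[n]$ with $Y\subseteq F_i$ for some $i$; its elements are faces and $|\Delta|$ is their number. $\partial^+f$ is the linear space spanned by all partial derivatives of $f$ of order $r$ with $1\le r\le\deg(f)-1$. For a face $F$, $\partial f/\partial F$ denotes the polynomial obtained from $f$ by differentiating once with respect to each variable $X_j$, $j\in F$. -}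

module Defs where

open import Data.Nat as ℕ using (ℕ; zero; suc; _⊔_; _∸_; _≤_)
open import Data.Integer using (+_)
open import Data.Rational using (ℚ; 0ℚ; 1ℚ; _+_; _*_; _/_)
open import Data.Rational.Properties using (_≟_)
open import Data.Fin using (Fin; _↑ˡ_; _↑ʳ_)
open import Data.Fin.Subset using (Subset; Nonempty; _⊆_; _∈_; ∣_∣)
open import Data.Fin.Subset.Properties using (_∈?_; nonempty?; _⊆?_)
open import Data.Bool using (Bool; true; false)
open import Data.Vec as V using (Vec; []; _∷_; lookup; updateAt; replicate)
open import Data.Vec.Properties as VP using ()
open import Data.List as L using (List; []; _∷_; _++_; map; foldr; filter; length; allFin; concatMap; zipWith)
open import Data.List.Relation.Unary.All using (All)
open import Data.List.Membership.Propositional renaming (_∈_ to _∈ˡ_)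
open import Data.Product using (Σ; ∃; ∃-syntax; _×_; _,_)
open import Relation.Nullary using (Dec; yes; no; ¬_; _×-dec_)
open import Relation.Nullary.Decidable using (⌊_⌋)
open import Relation.Binary.PropositionalEquality using (_≡_)
open import Data.Fin.Properties using (any?)

-- Polynomials over ℚ in N variables, as finite lists of terms
-- (coefficient, exponent vector).  Two polynomials are equal when all
-- their coefficients agree.

Mono : ℕ → Set
Mono N = Vec ℕ N

Poly : ℕ → Set
Poly N = List (ℚ × Mono N)

coeff : ∀ {N} → Poly N → Mono N → ℚ
coeff [] α = 0ℚ
coeff ((c , β) ∷ p) α with VP.≡-dec ℕ._≟_ β α
... | yes _ = c + coeff p α
... | no  _ = coeff p α

infix 4 _≈_
_≈_ : ∀ {N} → Poly N → Poly N → Set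
p ≈ q = ∀ α → coeff p α ≡ coeff q α

zeroP : ∀ {N} → Poly N
zeroP = []

scale : ∀ {N} → ℚ → Poly N → Poly N
scale c = map (λ { (a , α) → (c * a , α) })

lincomb : ∀ {N} → List (ℚ × Poly N) → Poly N
lincomb = foldr (λ { (c , p) acc → scale c p ++ acc }) []

totDeg : ∀ {N} → Mono N → ℕ
totDeg = V.sum

-- degree of a polynomial: maximal total degree of a monomial with
-- nonzero coefficient (0 for the zero polynomial)
deg : ∀ {N} → Poly N → ℕ
deg p = foldr (λ { (_ , α) acc → degTerm α ⊔ acc }) 0 p
  where
  degTerm : _ → ℕ
  degTerm α with coeff p α ≟ 0ℚ
  ... | yes _ = 0
  ... | no  _ = totDeg α

∂ : ∀ {N} → Fin N → Poly N → Poly N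
∂ j = concatMap dterm
  where
  dterm : _ → Poly _
  dterm (c , α) with lookup α j
  ... | zero  = []
  ... | suc k = (c * ((+ suc k) / 1) , updateAt α j ℕ.pred) ∷ []

∂w : ∀ {N} → List (Fin N) → Poly N → Poly N
∂w w p = foldr ∂ p w

-- p lies in ∂⁺f: p is a linear combination of partial derivatives of f
-- of order r with 1 ≤ r ≤ deg f - 1
In∂⁺ : ∀ {N} → Poly N → Poly N → Set
In∂⁺ f p =
  Σ (List (ℚ × List (Fin _))) λ ts →
    All (λ { (_ , w) → 1 ≤ length w × length w ≤ deg f ∸ 1 }) ts ×
    p ≈ lincomb (map (λ { (c , w) → (c , ∂w w f) }) ts)

InSpan : ∀ {N} → List (Poly N) → Poly N → Set
InSpan B p = Σ (List ℚ) λ cs → length cs ≡ length B × p ≈ lincomb (L.zip cs B)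

LinIndep : ∀ {N} → List (Poly N) → Set
LinIndep B = ∀ (cs : List ℚ) → length cs ≡ length B →
  lincomb (L.zip cs B) ≈ zeroP → All (_≡ 0ℚ) cs

IsBasis∂⁺ : ∀ {N} → Poly N → List (Poly N) → Set
IsBasis∂⁺ f B = All (In∂⁺ f) B × (∀ p → In∂⁺ f p → InSpan B p) × LinIndep B

X : ∀ {n m} → Fin n → Fin (n ℕ.+ m)
X {m = m} j = j ↑ˡ m

Y : ∀ {n m} → Fin m → Fin (n ℕ.+ m)
Y {n = n} i = n ↑ʳ i

elems : ∀ {n} → Subset n → List (Fin n)
elems S = filter (_∈? S) (allFin _)

monoX : ∀ {n m} → Subset n → Mono (n ℕ.+ m)
monoX {m = m} S = foldr (λ j α → updateAt α (X j) suc) (replicate _ 0) (elems S)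

monoYX : ∀ {n m} → Fin m → Subset n → Mono (n ℕ.+ m)
monoYX i S = updateAt (monoX S) (Y i) suc

fPoly : ∀ {n m} → (Fin m → Subset n) → Poly (n ℕ.+ m)
fPoly {m = m} F = map (λ i → (1ℚ , monoYX i (F i))) (allFin m)

allSubsets : ∀ n → List (Subset n)
allSubsets zero = [] ∷ []
allSubsets (suc n) = map (true ∷_) (allSubsets n) ++ map (false ∷_) (allSubsets n)

IsFace : ∀ {n m} → (Fin m → Subset n) → Subset n → Set
IsFace F S = Nonempty S × ∃[ i ] S ⊆ F i

isFace? : ∀ {n m} (F : Fin m → Subset n) S → Dec (IsFace F S)
isFace? F S = nonempty? S ×-dec any? (λ i → S ⊆? F i)

faces : ∀ {n m} → (Fin m → Subset n) → List (Subset n)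
faces {n} F = filter (isFace? F) (allSubsets n)

∣Δ∣ : ∀ {n m} → (Fin m → Subset n) → ℕ
∣Δ∣ F = length (faces F)

monoP : ∀ {n m} → Subset n → Poly (n ℕ.+ m)
monoP S = (1ℚ , monoX S) ∷ []

∂F : ∀ {n m} → (Fin m → Subset n) → Subset n → Poly (n ℕ.+ m)
∂F F S = ∂w (map X (elems S)) (fPoly F)

basis : ∀ {n m} → (Fin m → Subset n) → List (Poly (n ℕ.+ m))
basis F = map monoP (faces F) ++ map (∂F F) (faces F)

module Submission where

-- Each term Y_i ∏_{j∈F_i} X_j is the square-free monomial x^{supp i}, where
-- supp i = F_i ∪ {Y_i}, and for a word w of variables ∂_w x^T is x^{T∖w} when w is
-- repetition-free with letters in T ("w fits T") and 0 otherwise.  Hence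
-- ∂_w f = Σ_{i : w fits supp i} x^{supp i ∖ w}.  If w uses some Y_i, only the i-th term
-- survives and ∂_w f = ∏_{j∈S} X_j for a face S; if w uses no Y, then ∂_w f = ∂f/∂S
-- for the face S of its letters.  The order bound |w| ≤ deg f − 1 = d keeps these S
-- nonempty; this proves spanning, and read backwards it shows that each basis element
-- lies in ∂⁺f.  For independence, the coefficients of the basis at the monomials X^S
-- and Y_i X^{F_i ∖ S} (S ⊆ F_i) form an identity matrix.

open import Defs
open import Data.Nat using (ℕ; _*_)
open import Data.Fin using (Fin)
open import Data.Fin.Subset using (Subset; ∣_∣)
open import Data.List using (length)
open import Data.Product using (_×_)
open import Relation.Binary.PropositionalEquality using (_≡_)

open import Data.Nat as ℕ using (zero; suc; _≤_; _⊔_; _∸_; z≤n; s≤s)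
import Data.Nat.Properties as NP
open import Data.Rational using (ℚ; 0ℚ; 1ℚ) renaming (_+_ to _+q_; _*_ to _*q_)
import Data.Rational.Properties as QP
open import Algebra.Bundles using (CommutativeMonoid)
open import Algebra.Properties.CommutativeSemigroup
  (CommutativeMonoid.commutativeSemigroup QP.+-0-commutativeMonoid) using (interchange)
import Data.Fin as Fn
import Data.Fin.Properties as FP
import Data.Fin.Subset as Sub
open import Data.Fin.Subset using (Nonempty; _⊆_; ⁅_⁆)
import Data.Fin.Subset.Properties as SubP
open import Data.Bool using (Bool; true; false; _∧_; _∨_; not; if_then_else_)
import Data.Bool.Properties as BP
open import Data.Vec as V using (Vec; []; _∷_; lookup; updateAt; replicate; tabulate)
import Data.Vec.Properties as VP
open import Data.List as L using (List; []; _∷_; _++_; map; foldr; allFin; concatMap)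
import Data.List.Properties as LP
open import Data.List.Relation.Unary.All as All using (All; []; _∷_)
import Data.List.Relation.Unary.All.Properties as AllP
open import Data.List.Membership.Propositional using () renaming (_∈_ to _∈ˡ_; _∉_ to _∉ˡ_)
open import Data.List.Membership.Propositional.Properties
  using (∈-map⁺; ∈-map⁻; ∈-filter⁺; ∈-filter⁻; ∈-allFin; ∈-++⁺ˡ; ∈-++⁺ʳ; ∈-++⁻)
open import Data.List.Relation.Unary.Any using (here; there)
open import Data.List.Relation.Unary.Unique.Propositional using (Unique)
import Data.List.Relation.Unary.Unique.Propositional.Properties as UP
open import Data.List.Relation.Unary.AllPairs using ([]; _∷_)
open import Data.Product using (Σ-syntax; ∃; ∃-syntax; _,_; proj₁; proj₂)
open import Data.Sum using (_⊎_; inj₁; inj₂)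
open import Relation.Nullary using (yes; no; ¬_; does; contradiction)
open import Relation.Nullary.Decidable using (dec-true; dec-false)
open import Function using (_∘_)
open import Relation.Binary.PropositionalEquality
  using (refl; sym; trans; cong; cong₂; subst; _≢_; module ≡-Reasoning)

∈⇒1≤length : ∀ {A : Set} {x : A} {xs} → x ∈ˡ xs → 1 ≤ length xs
∈⇒1≤length {xs = _ ∷ _} _ = s≤s z≤n

1≤length⇒∈ : ∀ {A : Set} (xs : List A) → 1 ≤ length xs → Σ[ x ∈ A ] x ∈ˡ xs
1≤length⇒∈ (x ∷ _) _ = x , here refl

coeff-++ : ∀ {N} (p q : Poly N) α → coeff (p ++ q) α ≡ coeff p α +q coeff q α
coeff-++ [] q α = sym (QP.+-identityˡ _)
coeff-++ ((c , β) ∷ p) q α with VP.≡-dec ℕ._≟_ β α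
... | yes _ = trans (cong (c +q_) (coeff-++ p q α)) (sym (QP.+-assoc c _ _))
... | no _ = coeff-++ p q α

coeff-scale : ∀ {N} c (p : Poly N) α → coeff (scale c p) α ≡ c *q coeff p α
coeff-scale c [] α = sym (QP.*-zeroʳ c)
coeff-scale c ((a , β) ∷ p) α with VP.≡-dec ℕ._≟_ β α
... | yes _ = trans (cong ((c *q a) +q_) (coeff-scale c p α)) (sym (QP.*-distribˡ-+ c a _))
... | no _ = coeff-scale c p α

coeff-single-≡ : ∀ {N} c {β α : Mono N} → β ≡ α → coeff ((c , β) ∷ []) α ≡ c
coeff-single-≡ c {β} {α} β≡α with VP.≡-dec ℕ._≟_ β α
... | yes _ = QP.+-identityʳ c
... | no β≢α = contradiction β≡α β≢α

coeff-single-≢ : ∀ {N} c {β α : Mono N} → β ≢ α → coeff ((c , β) ∷ []) α ≡ 0ℚ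
coeff-single-≢ c {β} {α} β≢α with VP.≡-dec ℕ._≟_ β α
... | yes β≡α = contradiction β≡α β≢α
... | no _ = refl

sumℚ : List ℚ → ℚ
sumℚ = foldr _+q_ 0ℚ

coeff-concatMap : ∀ {N} {A : Set} (g : A → Poly N) (xs : List A) α →
  coeff (concatMap g xs) α ≡ sumℚ (map (λ x → coeff (g x) α) xs)
coeff-concatMap g [] α = refl
coeff-concatMap g (x ∷ xs) α =
  trans (coeff-++ (g x) (concatMap g xs) α) (cong (coeff (g x) α +q_) (coeff-concatMap g xs α))

sumℚ-vanish : ∀ {A : Set} (h : A → ℚ) (xs : List A) →
  (∀ {x} → x ∈ˡ xs → h x ≡ 0ℚ) → sumℚ (map h xs) ≡ 0ℚ
sumℚ-vanish h [] _ = refl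
sumℚ-vanish h (x ∷ xs) h0 =
  trans (cong₂ _+q_ (h0 (here refl)) (sumℚ-vanish h xs (h0 ∘ there))) (QP.+-identityˡ 0ℚ)

sumℚ-single : ∀ {A : Set} (h : A → ℚ) (xs : List A) (a : A) → Unique xs → a ∈ˡ xs →
  (∀ x → x ≢ a → h x ≡ 0ℚ) → sumℚ (map h xs) ≡ h a
sumℚ-single h (x ∷ xs) a (x∉xs ∷ _) (here refl) h0 =
  trans (cong (h x +q_) (sumℚ-vanish h xs (λ {y} y∈xs → h0 y (λ y≡x → All.lookup x∉xs y∈xs (sym y≡x)))))
        (QP.+-identityʳ _)
sumℚ-single h (x ∷ xs) a (x∉xs ∷ u) (there a∈xs) h0 =
  trans (cong₂ _+q_ (h0 x (λ x≡a → All.lookup x∉xs (subst (_∈ˡ xs) (sym x≡a) a∈xs) refl))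
                    (sumℚ-single h xs a u a∈xs h0))
        (QP.+-identityˡ _)

-- Weighted sums Σ_k c_k h(x_k), pairing a coefficient list with a list of items
-- (the surplus of the longer list is ignored, as in 'zip').

weightedSum : ∀ {A : Set} → List ℚ → List A → (A → ℚ) → ℚ
weightedSum (c ∷ cs) (x ∷ xs) h = c *q h x +q weightedSum cs xs h
weightedSum _ _ _ = 0ℚ

coeff-lincomb : ∀ {N} (cs : List ℚ) (B : List (Poly N)) α →
  coeff (lincomb (L.zip cs B)) α ≡ weightedSum cs B (λ p → coeff p α)
coeff-lincomb [] B α = refl
coeff-lincomb (c ∷ cs) [] α = refl
coeff-lincomb (c ∷ cs) (b ∷ B) α =
  trans (coeff-++ (scale c b) _ α) (cong₂ _+q_ (coeff-scale c b α) (coeff-lincomb cs B α))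

weightedSum-map : ∀ {A B : Set} (cs : List ℚ) (g : A → B) (xs : List A) (h : B → ℚ) →
  weightedSum cs (map g xs) h ≡ weightedSum cs xs (λ x → h (g x))
weightedSum-map [] g xs h = refl
weightedSum-map (c ∷ cs) g [] h = refl
weightedSum-map (c ∷ cs) g (x ∷ xs) h = cong (c *q h (g x) +q_) (weightedSum-map cs g xs h)

weightedSum-vanish : ∀ {A : Set} (cs : List ℚ) (xs : List A) (h : A → ℚ) →
  (∀ {x} → x ∈ˡ xs → h x ≡ 0ℚ) → weightedSum cs xs h ≡ 0ℚ
weightedSum-vanish [] xs h h0 = refl
weightedSum-vanish (c ∷ cs) [] h h0 = refl
weightedSum-vanish (c ∷ cs) (x ∷ xs) h h0 =
  trans (cong₂ _+q_ (trans (cong (c *q_) (h0 (here refl))) (QP.*-zeroʳ c))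
                    (weightedSum-vanish cs xs h (λ x∈xs → h0 (there x∈xs))))
        (QP.+-identityˡ 0ℚ)

weightedSum-zeros : ∀ {A : Set} (xs : List A) h → weightedSum (L.replicate (length xs) 0ℚ) xs h ≡ 0ℚ
weightedSum-zeros [] h = refl
weightedSum-zeros (x ∷ xs) h =
  trans (cong₂ _+q_ (QP.*-zeroˡ (h x)) (weightedSum-zeros xs h)) (QP.+-identityˡ 0ℚ)

weightedSum-+ : ∀ {A : Set} (cs ds : List ℚ) (xs : List A) h →
  length cs ≡ length xs → length ds ≡ length xs →
  weightedSum (L.zipWith _+q_ cs ds) xs h ≡ weightedSum cs xs h +q weightedSum ds xs h
weightedSum-+ [] [] [] h _ _ = sym (QP.+-identityˡ 0ℚ)
weightedSum-+ (c ∷ cs) (d ∷ ds) (x ∷ xs) h l₁ l₂ =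
  trans (cong₂ _+q_ (QP.*-distribʳ-+ (h x) c d)
                    (weightedSum-+ cs ds xs h (NP.suc-injective l₁) (NP.suc-injective l₂)))
        (interchange (c *q h x) (d *q h x) _ _)

weightedSum-scale : ∀ {A : Set} c (cs : List ℚ) (xs : List A) h →
  weightedSum (map (c *q_) cs) xs h ≡ c *q weightedSum cs xs h
weightedSum-scale c [] xs h = sym (QP.*-zeroʳ c)
weightedSum-scale c (x ∷ cs) [] h = sym (QP.*-zeroʳ c)
weightedSum-scale c (a ∷ cs) (x ∷ xs) h =
  trans (cong₂ _+q_ (QP.*-assoc c a _) (weightedSum-scale c cs xs h)) (sym (QP.*-distribˡ-+ c _ _))

span-≈ : ∀ {N} (B : List (Poly N)) {p q} → p ≈ q → InSpan B q → InSpan B p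
span-≈ B p≈q (cs , l , q≈) = cs , l , (λ α → trans (p≈q α) (q≈ α))

span-zero : ∀ {N} (B : List (Poly N)) {p} → p ≈ zeroP → InSpan B p
span-zero B {p} p≈0 = L.replicate (length B) 0ℚ , LP.length-replicate (length B) , λ α → begin
  coeff p α                                                  ≡⟨ p≈0 α ⟩
  0ℚ                                                         ≡⟨ sym (weightedSum-zeros B _) ⟩
  weightedSum (L.replicate (length B) 0ℚ) B (λ p → coeff p α) ≡⟨ sym (coeff-lincomb (L.replicate (length B) 0ℚ) B α) ⟩
  coeff (lincomb (L.zip (L.replicate (length B) 0ℚ) B)) α     ∎
  where open ≡-Reasoning

span-add : ∀ {N} (B : List (Poly N)) {p q} → InSpan B p → InSpan B q → InSpan B (p ++ q)
span-add B {p} {q} (cs , l₁ , p≈) (ds , l₂ , q≈) = L.zipWith _+q_ cs ds , length-sum , λ α → begin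
  coeff (p ++ q) α                                            ≡⟨ coeff-++ p q α ⟩
  coeff p α +q coeff q α                                      ≡⟨ cong₂ _+q_ (trans (p≈ α) (coeff-lincomb cs B α))
                                                                            (trans (q≈ α) (coeff-lincomb ds B α)) ⟩
  weightedSum cs B (λ r → coeff r α) +q weightedSum ds B (λ r → coeff r α)
                                                              ≡⟨ sym (weightedSum-+ cs ds B _ l₁ l₂) ⟩
  weightedSum (L.zipWith _+q_ cs ds) B (λ r → coeff r α)      ≡⟨ sym (coeff-lincomb (L.zipWith _+q_ cs ds) B α) ⟩
  coeff (lincomb (L.zip (L.zipWith _+q_ cs ds) B)) α          ∎
  where
  open ≡-Reasoning
  length-sum : length (L.zipWith _+q_ cs ds) ≡ length B
  length-sum = begin
    length (L.zipWith _+q_ cs ds) ≡⟨ LP.length-zipWith _+q_ cs ds ⟩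
    length cs ℕ.⊓ length ds       ≡⟨ cong₂ ℕ._⊓_ l₁ l₂ ⟩
    length B ℕ.⊓ length B         ≡⟨ NP.⊓-idem (length B) ⟩
    length B                      ∎

span-scale : ∀ {N} (B : List (Poly N)) c {p} → InSpan B p → InSpan B (scale c p)
span-scale B c {p} (cs , l , p≈) = map (c *q_) cs , trans (LP.length-map _ cs) l , λ α → begin
  coeff (scale c p) α                          ≡⟨ coeff-scale c p α ⟩
  c *q coeff p α                               ≡⟨ cong (c *q_) (trans (p≈ α) (coeff-lincomb cs B α)) ⟩
  c *q weightedSum cs B (λ r → coeff r α)      ≡⟨ sym (weightedSum-scale c cs B _) ⟩
  weightedSum (map (c *q_) cs) B (λ r → coeff r α) ≡⟨ sym (coeff-lincomb (map (c *q_) cs) B α) ⟩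
  coeff (lincomb (L.zip (map (c *q_) cs) B)) α ∎
  where open ≡-Reasoning

span-elem : ∀ {N} (B : List (Poly N)) {q} → q ∈ˡ B → InSpan B q
span-elem (b ∷ B) (here refl) =
  1ℚ ∷ L.replicate (length B) 0ℚ , cong suc (LP.length-replicate (length B)) , λ α → sym (begin
    coeff (lincomb (L.zip (1ℚ ∷ L.replicate (length B) 0ℚ) (b ∷ B))) α
      ≡⟨ coeff-lincomb (1ℚ ∷ L.replicate (length B) 0ℚ) (b ∷ B) α ⟩
    1ℚ *q coeff b α +q weightedSum (L.replicate (length B) 0ℚ) B (λ r → coeff r α)
      ≡⟨ cong₂ _+q_ (QP.*-identityˡ (coeff b α)) (weightedSum-zeros B _) ⟩
    coeff b α +q 0ℚ
      ≡⟨ QP.+-identityʳ (coeff b α) ⟩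
    coeff b α ∎)
  where open ≡-Reasoning
span-elem (b ∷ B) {q} (there q∈B) with span-elem B q∈B
... | cs , l , q≈ = 0ℚ ∷ cs , cong suc l , λ α → begin
  coeff q α                                            ≡⟨ trans (q≈ α) (coeff-lincomb cs B α) ⟩
  weightedSum cs B (λ r → coeff r α)                   ≡⟨ sym (QP.+-identityˡ _) ⟩
  0ℚ +q weightedSum cs B (λ r → coeff r α)             ≡⟨ cong (_+q _) (sym (QP.*-zeroˡ (coeff b α))) ⟩
  0ℚ *q coeff b α +q weightedSum cs B (λ r → coeff r α) ≡⟨ sym (coeff-lincomb (0ℚ ∷ cs) (b ∷ B) α) ⟩
  coeff (lincomb (L.zip (0ℚ ∷ cs) (b ∷ B))) α          ∎
  where open ≡-Reasoning

span-lincomb : ∀ {N} {A : Set} (B : List (Poly N)) (h : A → ℚ × Poly N) (ts : List A) →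
  All (λ t → InSpan B (proj₂ (h t))) ts → InSpan B (lincomb (map h ts))
span-lincomb B h [] [] = span-zero B {[]} (λ α → refl)
span-lincomb B h (t ∷ ts) (s ∷ ss) =
  span-add B {scale (proj₁ (h t)) (proj₂ (h t))} {lincomb (map h ts)}
    (span-scale B (proj₁ (h t)) {proj₂ (h t)} s) (span-lincomb B h ts ss)

lincomb-single : ∀ {N} (q : Poly N) → lincomb ((1ℚ , q) ∷ []) ≈ q
lincomb-single q α = begin
  coeff (scale 1ℚ q ++ []) α      ≡⟨ coeff-++ (scale 1ℚ q) [] α ⟩
  coeff (scale 1ℚ q) α +q 0ℚ      ≡⟨ QP.+-identityʳ _ ⟩
  coeff (scale 1ℚ q) α            ≡⟨ coeff-scale 1ℚ q α ⟩
  1ℚ *q coeff q α                 ≡⟨ QP.*-identityˡ _ ⟩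
  coeff q α                       ∎
  where open ≡-Reasoning

∂⁺-≈ : ∀ {N} (f : Poly N) {p q} → p ≈ q → In∂⁺ f q → In∂⁺ f p
∂⁺-≈ f p≈q (ts , orders , q≈) = ts , orders , (λ α → trans (p≈q α) (q≈ α))

-- A unitriangular system: if a matrix e is the identity on a duplicate-free list
-- xs, the only solution of Σ_k c_k e(x_k, y) = 0 (for all y ∈ xs) is c = 0.  By
-- induction along xs: the equation at the first index forces the first coefficient to 0.
diagonal-solve : ∀ {A : Set} (e : A → A → ℚ) (xs : List A) → Unique xs →
  (∀ {x} → x ∈ˡ xs → e x x ≡ 1ℚ) → (∀ {x y} → x ∈ˡ xs → y ∈ˡ xs → x ≢ y → e x y ≡ 0ℚ) →
  (cs : List ℚ) → length cs ≡ length xs →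
  (∀ {y} → y ∈ˡ xs → weightedSum cs xs (λ x → e x y) ≡ 0ℚ) → All (_≡ 0ℚ) cs
diagonal-solve e [] _ _ _ [] _ _ = []
diagonal-solve e (x ∷ xs) (x∉xs ∷ u) diag off (c ∷ cs) l sums≡0 =
  c≡0 ∷ diagonal-solve e xs u (diag ∘ there) (λ y∈ z∈ → off (there y∈) (there z∈)) cs (NP.suc-injective l) rest≡0
  where
  open ≡-Reasoning
  rest-at-x : weightedSum cs xs (λ z → e z x) ≡ 0ℚ
  rest-at-x = weightedSum-vanish cs xs _ λ z∈xs → off (there z∈xs) (here refl) (λ z≡x → All.lookup x∉xs z∈xs (sym z≡x))
  c≡0 : c ≡ 0ℚ
  c≡0 = begin
    c                                          ≡⟨ sym (QP.*-identityʳ c) ⟩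
    c *q 1ℚ                                    ≡⟨ cong (c *q_) (sym (diag (here refl))) ⟩
    c *q e x x                                 ≡⟨ sym (QP.+-identityʳ _) ⟩
    c *q e x x +q 0ℚ                           ≡⟨ cong (c *q e x x +q_) (sym rest-at-x) ⟩
    weightedSum (c ∷ cs) (x ∷ xs) (λ z → e z x) ≡⟨ sums≡0 (here refl) ⟩
    0ℚ                                         ∎
  rest≡0 : ∀ {y} → y ∈ˡ xs → weightedSum cs xs (λ z → e z y) ≡ 0ℚ
  rest≡0 {y} y∈xs = begin
    weightedSum cs xs (λ z → e z y)                     ≡⟨ sym (QP.+-identityˡ _) ⟩
    0ℚ +q weightedSum cs xs (λ z → e z y)               ≡⟨ cong (_+q _) (sym (QP.*-zeroˡ (e x y))) ⟩
    0ℚ *q e x y +q weightedSum cs xs (λ z → e z y)      ≡⟨ cong (λ c′ → c′ *q e x y +q _) (sym c≡0) ⟩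
    weightedSum (c ∷ cs) (x ∷ xs) (λ z → e z y)         ≡⟨ sums≡0 (there y∈xs) ⟩
    0ℚ                                                  ∎

diagonal-indep : ∀ {N} {A : Set} (xs : List A) → Unique xs → (b : A → Poly N) (a : A → Mono N) →
  (∀ {x} → x ∈ˡ xs → coeff (b x) (a x) ≡ 1ℚ) →
  (∀ {x y} → x ∈ˡ xs → y ∈ˡ xs → x ≢ y → coeff (b x) (a y) ≡ 0ℚ) →
  LinIndep (map b xs)
diagonal-indep xs u b a diag off cs l comb≈0 =
  diagonal-solve (λ x y → coeff (b x) (a y)) xs u diag off cs (trans l (LP.length-map b xs)) λ {y} _ → begin
    weightedSum cs xs (λ x → coeff (b x) (a y))     ≡⟨ sym (weightedSum-map cs b xs (λ p → coeff p (a y))) ⟩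
    weightedSum cs (map b xs) (λ p → coeff p (a y)) ≡⟨ sym (coeff-lincomb cs (map b xs) (a y)) ⟩
    coeff (lincomb (L.zip cs (map b xs))) (a y)     ≡⟨ comb≈0 (a y) ⟩
    0ℚ                                              ∎
  where open ≡-Reasoning

-- The degree of a polynomial.  'deg p' is a right fold over the terms of p whose
-- step function (defined locally in Defs) is recovered here by unification; it
-- contributes the total degree of a term exactly when that term's monomial has
-- nonzero coefficient in p.

deg-as-fold : ∀ {N} (p : Poly N) → Σ[ g ∈ (ℚ × Mono N → ℕ → ℕ) ] deg p ≡ foldr g 0 p
deg-as-fold p = _ , refl

degStep : ∀ {N} (p : Poly N) → ℚ × Mono N → ℕ → ℕ
degStep p = proj₁ (deg-as-fold p)

degStep-≤ : ∀ {N} (p : Poly N) t acc → degStep p t acc ≤ totDeg (proj₂ t) ⊔ acc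
degStep-≤ p t acc with coeff p (proj₂ t) QP.≟ 0ℚ
... | yes _ = NP.m≤n⊔m _ acc
... | no _ = NP.≤-refl

degStep-≥ : ∀ {N} (p : Poly N) t acc → coeff p (proj₂ t) ≢ 0ℚ → totDeg (proj₂ t) ≤ degStep p t acc
degStep-≥ p t acc c≢0 with coeff p (proj₂ t) QP.≟ 0ℚ
... | yes c≡0 = contradiction c≡0 c≢0
... | no _ = NP.m≤m⊔n _ acc

degStep-mono : ∀ {N} (p : Poly N) t acc → acc ≤ degStep p t acc
degStep-mono p t acc with coeff p (proj₂ t) QP.≟ 0ℚ
... | yes _ = NP.m≤n⊔m _ acc
... | no _ = NP.m≤n⊔m _ acc

deg-≤ : ∀ {N} (p : Poly N) K → (∀ {t} → t ∈ˡ p → totDeg (proj₂ t) ≤ K) → deg p ≤ K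
deg-≤ p K bound = go p bound
  where
  go : ∀ ts → (∀ {t} → t ∈ˡ ts → totDeg (proj₂ t) ≤ K) → foldr (degStep p) 0 ts ≤ K
  go [] _ = z≤n
  go (t ∷ ts) bound′ = NP.≤-trans (degStep-≤ p t _) (NP.⊔-lub (bound′ (here refl)) (go ts (bound′ ∘ there)))

deg-≥ : ∀ {N} (p : Poly N) {t} → t ∈ˡ p → coeff p (proj₂ t) ≢ 0ℚ → totDeg (proj₂ t) ≤ deg p
deg-≥ p {t} t∈p c≢0 = go p t∈p
  where
  go : ∀ ts → t ∈ˡ ts → totDeg (proj₂ t) ≤ foldr (degStep p) 0 ts
  go (t ∷ ts) (here refl) = degStep-≥ p t _ c≢0
  go (s ∷ ts) (there t∈ts) = NP.≤-trans (go ts t∈ts) (degStep-mono p s _)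

b2n : Bool → ℕ
b2n true = 1
b2n false = 0

b2n-injective : ∀ {a b} → b2n a ≡ b2n b → a ≡ b
b2n-injective {true} {true} _ = refl
b2n-injective {false} {false} _ = refl

χ : ∀ {N} → Subset N → Mono N
χ = V.map b2n

lookup-χ : ∀ {N} (T : Subset N) v → lookup (χ T) v ≡ b2n (lookup T v)
lookup-χ T v = VP.lookup-map v b2n T

vec-ext : ∀ {A : Set} {N} {xs ys : Vec A N} → (∀ i → lookup xs i ≡ lookup ys i) → xs ≡ ys
vec-ext {xs = xs} {ys} same = trans (sym (VP.tabulate∘lookup xs)) (trans (VP.tabulate-cong same) (VP.tabulate∘lookup ys))

χ-injective : ∀ {N} {T U : Subset N} → χ T ≡ χ U → ∀ v → lookup T v ≡ lookup U v
χ-injective {T = T} {U} χT≡χU v =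
  b2n-injective (trans (sym (lookup-χ T v)) (trans (cong (λ α → lookup α v) χT≡χU) (lookup-χ U v)))

totDeg-χ : ∀ {N} (T : Subset N) → totDeg (χ T) ≡ ∣ T ∣
totDeg-χ [] = refl
totDeg-χ (true ∷ T) = cong suc (totDeg-χ T)
totDeg-χ (false ∷ T) = totDeg-χ T

∣∣-pos : ∀ {N} (U : Subset N) v → lookup U v ≡ true → 1 ≤ ∣ U ∣
∣∣-pos (true ∷ U) Fn.zero _ = s≤s z≤n
∣∣-pos (b ∷ U) (Fn.suc v) v∈U = NP.≤-trans (∣∣-pos U v v∈U) (SubP.∣p∣≤∣x∷p∣ b U)

∣∣-pos⁻ : ∀ {N} (U : Subset N) → 1 ≤ ∣ U ∣ → ∃[ v ] lookup U v ≡ true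
∣∣-pos⁻ (true ∷ U) _ = Fn.zero , refl
∣∣-pos⁻ (false ∷ U) 1≤∣U∣ with ∣∣-pos⁻ U 1≤∣U∣
... | v , v∈U = Fn.suc v , v∈U

∣⊕∣ : ∀ {a b} (S : Subset a) (R : Subset b) → ∣ S V.++ R ∣ ≡ ∣ S ∣ ℕ.+ ∣ R ∣
∣⊕∣ [] R = refl
∣⊕∣ (true ∷ S) R = cong suc (∣⊕∣ S R)
∣⊕∣ (false ∷ S) R = ∣⊕∣ S R

bool-ext : ∀ {a b : Bool} → (a ≡ true → b ≡ true) → (b ≡ true → a ≡ true) → a ≡ b
bool-ext {true} {true} _ _ = refl
bool-ext {true} {false} a⇒b _ = sym (a⇒b refl)
bool-ext {false} {true} _ b⇒a = b⇒a refl
bool-ext {false} {false} _ _ = refl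

∧-not-∧-not : ∀ a b → (b ≡ true → a ≡ true) → a ∧ not (a ∧ not b) ≡ b
∧-not-∧-not true b _ = BP.not-involutive b
∧-not-∧-not false false _ = refl
∧-not-∧-not false true b⇒a = b⇒a refl

∧-true : ∀ {a b : Bool} → a ∧ b ≡ true → a ≡ true × b ≡ true
∧-true {true} {true} _ = refl , refl

∧not-cancel : ∀ a b c → (b ≡ true → a ≡ true) → (c ≡ true → a ≡ true) → a ∧ not b ≡ a ∧ not c → b ≡ c
∧not-cancel true b c _ _ same = BP.not-injective same
∧not-cancel false false false _ _ _ = refl
∧not-cancel false true c b⇒a _ _ with b⇒a refl
... | ()
∧not-cancel false false true _ c⇒a _ with c⇒a refl
... | ()

-- Words of variables record mixed partial derivatives ∂_w = ∂_{w₁} ∘ … ∘ ∂_{w_k}.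
-- 'occurs w v': the variable v occurs in w;  'fits T w': w is repetition-free
-- and all its letters lie in T;  'remove T w': T with the letters of w deleted.

occurs : ∀ {N} → List (Fin N) → Fin N → Bool
occurs [] v = false
occurs (j ∷ w) v = does (j Fn.≟ v) ∨ occurs w v

fits : ∀ {N} → Subset N → List (Fin N) → Bool
fits T [] = true
fits T (j ∷ w) = fits T w ∧ (lookup T j ∧ not (occurs w j))

remove : ∀ {N} → Subset N → List (Fin N) → Subset N
remove T w = tabulate (λ v → lookup T v ∧ not (occurs w v))

lookup-remove : ∀ {N} (T : Subset N) w v → lookup (remove T w) v ≡ lookup T v ∧ not (occurs w v)
lookup-remove T w v = VP.lookup∘tabulate _ v

occurs⇒∈ : ∀ {N} (w : List (Fin N)) {v} → occurs w v ≡ true → v ∈ˡ w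
occurs⇒∈ (j ∷ w) {v} occ with j Fn.≟ v
... | yes j≡v = here (sym j≡v)
... | no _ = there (occurs⇒∈ w occ)

∈⇒occurs : ∀ {N} {w : List (Fin N)} {v} → v ∈ˡ w → occurs w v ≡ true
∈⇒occurs {w = j ∷ w} {v} (here refl) = cong (_∨ occurs w v) (dec-true (v Fn.≟ v) refl)
∈⇒occurs {w = j ∷ w} (there v∈w) = trans (cong (_ ∨_) (∈⇒occurs v∈w)) (BP.∨-zeroʳ _)

∉⇒¬occurs : ∀ {N} (w : List (Fin N)) {v} → v ∉ˡ w → occurs w v ≡ false
∉⇒¬occurs w {v} v∉w = BP.¬-not (v∉w ∘ occurs⇒∈ w)

fits⇒⊆ : ∀ {N} (T : Subset N) (w : List (Fin N)) → fits T w ≡ true → ∀ {v} → v ∈ˡ w → lookup T v ≡ true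
fits⇒⊆ T (j ∷ w) ok (here refl) = proj₁ (∧-true (proj₂ (∧-true {fits T w} ok)))
fits⇒⊆ T (j ∷ w) ok (there v∈w) = fits⇒⊆ T w (proj₁ (∧-true {fits T w} ok)) v∈w

fits⇒unique : ∀ {N} (T : Subset N) (w : List (Fin N)) → fits T w ≡ true → Unique w
fits⇒unique T [] _ = []
fits⇒unique T (j ∷ w) ok with ∧-true {fits T w} ok
... | okw , okj = All.tabulate (λ v∈w j≡v → j∉w (subst (_∈ˡ w) (sym j≡v) v∈w)) ∷ fits⇒unique T w okw
  where
  j∉w : j ∉ˡ w
  j∉w j∈w with ∧-true {lookup T j} okj
  ... | _ , ¬occ = contradiction (trans (sym (∈⇒occurs j∈w)) (BP.not-injective ¬occ)) (λ ())

fits-intro : ∀ {N} (T : Subset N) (w : List (Fin N)) → Unique w →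
  (∀ {v} → v ∈ˡ w → lookup T v ≡ true) → fits T w ≡ true
fits-intro T [] _ _ = refl
fits-intro T (j ∷ w) (j∉w ∷ u) w⊆T =
  cong₂ _∧_ (fits-intro T w u (w⊆T ∘ there))
            (cong₂ _∧_ (w⊆T (here refl)) (cong not (∉⇒¬occurs w (λ j∈w → All.lookup j∉w j∈w refl))))

fits-false : ∀ {N} (T : Subset N) (w : List (Fin N)) {v} → v ∈ˡ w → lookup T v ≡ false → fits T w ≡ false
fits-false T w v∈w v∉T = BP.¬-not (λ ok → contradiction (trans (sym (fits⇒⊆ T w ok v∈w)) v∉T) (λ ()))

fits-sameLetters : ∀ {N} (T : Subset N) {w w′ : List (Fin N)} → Unique w → Unique w′ →
  (∀ v → occurs w v ≡ occurs w′ v) → fits T w ≡ fits T w′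
fits-sameLetters T {w} {w′} u u′ same = bool-ext
  (λ ok → fits-intro T w′ u′ (λ {v} v∈w′ → fits⇒⊆ T w ok (occurs⇒∈ w (trans (same v) (∈⇒occurs v∈w′)))))
  (λ ok → fits-intro T w u (λ {v} v∈w → fits⇒⊆ T w′ ok (occurs⇒∈ w′ (trans (sym (same v)) (∈⇒occurs v∈w)))))

remove-sameLetters : ∀ {N} (T : Subset N) {w w′ : List (Fin N)} →
  (∀ v → occurs w v ≡ occurs w′ v) → remove T w ≡ remove T w′
remove-sameLetters T same = VP.tabulate-cong (λ v → cong (λ b → lookup T v ∧ not b) (same v))

lookup-χ-remove : ∀ {N} (T : Subset N) w v → lookup (χ (remove T w)) v ≡ b2n (lookup T v ∧ not (occurs w v))
lookup-χ-remove T w v = trans (lookup-χ (remove T w) v) (cong b2n (lookup-remove T w v))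

remove-occurs : ∀ {N} (T : Subset N) w {v} → occurs w v ≡ true → lookup (remove T w) v ≡ false
remove-occurs T w {v} occ = trans (lookup-remove T w v) (trans (cong (λ b → lookup T v ∧ not b) occ) (BP.∧-zeroʳ _))

remove-[] : ∀ {N} (T : Subset N) → remove T [] ≡ T
remove-[] T = vec-ext (λ v → trans (lookup-remove T [] v) (BP.∧-identityʳ _))

remove-∷ : ∀ {N} (T : Subset N) w j → lookup T j ∧ not (occurs w j) ≡ true →
  updateAt (χ (remove T w)) j ℕ.pred ≡ χ (remove T (j ∷ w))
remove-∷ T w j j∈T∖w = vec-ext at
  where
  at : ∀ v → lookup (updateAt (χ (remove T w)) j ℕ.pred) v ≡ lookup (χ (remove T (j ∷ w))) v
  at v with j Fn.≟ v
  ... | yes refl = begin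
    lookup (updateAt (χ (remove T w)) j ℕ.pred) j     ≡⟨ VP.lookup∘updateAt j (χ (remove T w)) ⟩
    ℕ.pred (lookup (χ (remove T w)) j)                ≡⟨ cong ℕ.pred (trans (lookup-χ-remove T w j) (cong b2n j∈T∖w)) ⟩
    0                                                  ≡⟨ cong b2n (sym (BP.∧-zeroʳ (lookup T j))) ⟩
    b2n (lookup T j ∧ not (true ∨ occurs w j))         ≡⟨ cong (λ b → b2n (lookup T j ∧ not (b ∨ occurs w j)))
                                                                (sym (dec-true (j Fn.≟ j) refl)) ⟩
    b2n (lookup T j ∧ not (occurs (j ∷ w) j))          ≡⟨ sym (lookup-χ-remove T (j ∷ w) j) ⟩
    lookup (χ (remove T (j ∷ w))) j                    ∎
    where open ≡-Reasoning
  ... | no j≢v = begin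
    lookup (updateAt (χ (remove T w)) j ℕ.pred) v     ≡⟨ VP.lookup∘updateAt′ v j (j≢v ∘ sym) (χ (remove T w)) ⟩
    lookup (χ (remove T w)) v                          ≡⟨ lookup-χ-remove T w v ⟩
    b2n (lookup T v ∧ not (occurs w v))                ≡⟨ cong (λ b → b2n (lookup T v ∧ not (b ∨ occurs w v)))
                                                                (sym (dec-false (j Fn.≟ v) j≢v)) ⟩
    b2n (lookup T v ∧ not (occurs (j ∷ w) v))          ≡⟨ sym (lookup-χ-remove T (j ∷ w) v) ⟩
    lookup (χ (remove T (j ∷ w))) v                    ∎
    where open ≡-Reasoning

totDeg-pred : ∀ {N} (α : Mono N) j {k} → lookup α j ≡ suc k → suc (totDeg (updateAt α j ℕ.pred)) ≡ totDeg α
totDeg-pred (a ∷ α) Fn.zero refl = refl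
totDeg-pred (a ∷ α) (Fn.suc j) αj≡1+k = trans (sym (NP.+-suc a _)) (cong (a ℕ.+_) (totDeg-pred α j αj≡1+k))

remove-∷-size : ∀ {N} (T : Subset N) w j → lookup T j ∧ not (occurs w j) ≡ true →
  suc ∣ remove T (j ∷ w) ∣ ≡ ∣ remove T w ∣
remove-∷-size T w j j∈T∖w = begin
  suc ∣ remove T (j ∷ w) ∣                             ≡⟨ cong suc (sym (totDeg-χ (remove T (j ∷ w)))) ⟩
  suc (totDeg (χ (remove T (j ∷ w))))                  ≡⟨ cong (suc ∘ totDeg) (sym (remove-∷ T w j j∈T∖w)) ⟩
  suc (totDeg (updateAt (χ (remove T w)) j ℕ.pred))    ≡⟨ totDeg-pred (χ (remove T w)) j
                                                            (trans (lookup-χ-remove T w j) (cong b2n j∈T∖w)) ⟩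
  totDeg (χ (remove T w))                              ≡⟨ totDeg-χ (remove T w) ⟩
  ∣ remove T w ∣                                       ∎
  where open ≡-Reasoning

∣remove∣ : ∀ {N} (T : Subset N) (w : List (Fin N)) → fits T w ≡ true → ∣ remove T w ∣ ℕ.+ length w ≡ ∣ T ∣
∣remove∣ T [] _ = trans (NP.+-identityʳ _) (cong ∣_∣ (remove-[] T))
∣remove∣ T (j ∷ w) ok with ∧-true {fits T w} ok
... | okw , j∈T∖w = begin
  ∣ remove T (j ∷ w) ∣ ℕ.+ suc (length w)   ≡⟨ NP.+-suc _ (length w) ⟩
  suc ∣ remove T (j ∷ w) ∣ ℕ.+ length w     ≡⟨ cong (ℕ._+ length w) (remove-∷-size T w j j∈T∖w) ⟩
  ∣ remove T w ∣ ℕ.+ length w               ≡⟨ ∣remove∣ T w okw ⟩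
  ∣ T ∣                                     ∎
  where open ≡-Reasoning

∂-single-0 : ∀ {N} (j : Fin N) c (α : Mono N) → lookup α j ≡ 0 → ∂ j ((c , α) ∷ []) ≡ []
∂-single-0 j c α αj≡0 with lookup α j | αj≡0
... | zero | refl = refl

∂-single-1 : ∀ {N} (j : Fin N) c (α : Mono N) → lookup α j ≡ 1 →
  ∂ j ((c , α) ∷ []) ≡ (c *q 1ℚ , updateAt α j ℕ.pred) ∷ []
∂-single-1 j c α αj≡1 with lookup α j | αj≡1
... | suc zero | refl = refl

∂w-χ : ∀ {N} (w : List (Fin N)) c (T : Subset N) →
  ∂w w ((c , χ T) ∷ []) ≡ (if fits T w then (c , χ (remove T w)) ∷ [] else [])
∂w-χ [] c T = cong (λ U → (c , χ U) ∷ []) (sym (remove-[] T))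
∂w-χ (j ∷ w) c T rewrite ∂w-χ w c T with fits T w
... | false = refl
... | true with lookup T j ∧ not (occurs w j) in j∈T∖w
...   | true = trans (∂-single-1 j c (χ (remove T w)) (trans (lookup-χ-remove T w j) (cong b2n j∈T∖w)))
                     (cong₂ (λ a β → (a , β) ∷ []) (QP.*-identityʳ c) (remove-∷ T w j j∈T∖w))
...   | false = ∂-single-0 j c (χ (remove T w)) (trans (lookup-χ-remove T w j) (cong b2n j∈T∖w))

∂w-[] : ∀ {N} (w : List (Fin N)) → ∂w w [] ≡ []
∂w-[] [] = refl
∂w-[] (j ∷ w) = cong (∂ j) (∂w-[] w)

∂w-++ : ∀ {N} (w : List (Fin N)) (p q : Poly N) → ∂w w (p ++ q) ≡ ∂w w p ++ ∂w w q
∂w-++ [] p q = refl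
∂w-++ (j ∷ w) p q = trans (cong (∂ j) (∂w-++ w p q)) (LP.concatMap-++ _ (∂w w p) (∂w w q))

∂w-map : ∀ {N} {A : Set} (w : List (Fin N)) (h : A → ℚ × Mono N) (xs : List A) →
  ∂w w (map h xs) ≡ concatMap (λ x → ∂w w (h x ∷ [])) xs
∂w-map w h [] = ∂w-[] w
∂w-map w h (x ∷ xs) = trans (∂w-++ w (h x ∷ []) (map h xs)) (cong (∂w w (h x ∷ []) ++_) (∂w-map w h xs))

lookup-⁅⁆ : ∀ {k} (i : Fin k) → lookup ⁅ i ⁆ i ≡ true
lookup-⁅⁆ i = VP.[]=⇒lookup (SubP.x∈⁅x⁆ i)

lookup-⁅⁆-≢ : ∀ {k} (i i′ : Fin k) → i′ ≢ i → lookup ⁅ i ⁆ i′ ≡ false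
lookup-⁅⁆-≢ i i′ i′≢i = BP.¬-not (i′≢i ∘ SubP.x∈⁅y⁆⇒x≡y i ∘ VP.lookup⇒[]= i′ ⁅ i ⁆)

lookup-⊥ : ∀ {k} (i : Fin k) → lookup (Sub.⊥ {k}) i ≡ false
lookup-⊥ i = VP.lookup-replicate i false

⊆⇒lookup : ∀ {k} {S T : Subset k} → S ⊆ T → ∀ j → lookup S j ≡ true → lookup T j ≡ true
⊆⇒lookup {S = S} {T} S⊆T j j∈S = VP.[]=⇒lookup (S⊆T (VP.lookup⇒[]= j S j∈S))

lookup⇒⊆ : ∀ {k} {S T : Subset k} → (∀ j → lookup S j ≡ true → lookup T j ≡ true) → S ⊆ T
lookup⇒⊆ {T = T} incl {j} j∈S = VP.lookup⇒[]= j T (incl j (VP.[]=⇒lookup j∈S))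

elems-complete : ∀ {k} (S : Subset k) j → lookup S j ≡ true → j ∈ˡ elems S
elems-complete S j j∈S = ∈-filter⁺ (SubP._∈? S) (∈-allFin j) (VP.lookup⇒[]= j S j∈S)

elems-sound : ∀ {k} (S : Subset k) {j} → j ∈ˡ elems S → lookup S j ≡ true
elems-sound S j∈ = VP.[]=⇒lookup (proj₂ (∈-filter⁻ (SubP._∈? S) {xs = allFin _} j∈))

elems-unique : ∀ {k} (S : Subset k) → Unique (elems S)
elems-unique {k} S = UP.filter⁺ (SubP._∈? S) (UP.allFin⁺ k)

allSubsets-complete : ∀ {k} (S : Subset k) → S ∈ˡ allSubsets k
allSubsets-complete [] = here refl
allSubsets-complete {suc k} (true ∷ S) = ∈-++⁺ˡ (∈-map⁺ (true ∷_) (allSubsets-complete S))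
allSubsets-complete {suc k} (false ∷ S) =
  ∈-++⁺ʳ (map (true ∷_) (allSubsets k)) (∈-map⁺ (false ∷_) (allSubsets-complete S))

allSubsets-unique : ∀ k → Unique (allSubsets k)
allSubsets-unique zero = [] ∷ []
allSubsets-unique (suc k) =
  UP.++⁺ (UP.map⁺ VP.∷-injectiveʳ (allSubsets-unique k)) (UP.map⁺ VP.∷-injectiveʳ (allSubsets-unique k)) disjoint
  where
  disjoint : ∀ {S} → ¬ (S ∈ˡ map (true ∷_) (allSubsets k) × S ∈ˡ map (false ∷_) (allSubsets k))
  disjoint (S∈₁ , S∈₂) with ∈-map⁻ (true ∷_) S∈₁ | ∈-map⁻ (false ∷_) S∈₂
  ... | _ , _ , refl | _ , _ , eq with VP.∷-injectiveˡ eq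
  ... | ()

module Variables (n m : ℕ) where

  N : ℕ
  N = n ℕ.+ m

  X-or-Y : ∀ (v : Fin N) → (∃[ j ] v ≡ X j) ⊎ (∃[ i ] v ≡ Y i)
  X-or-Y v with Fn.splitAt n v in eq
  ... | inj₁ j = inj₁ (j , sym (FP.splitAt⁻¹-↑ˡ eq))
  ... | inj₂ i = inj₂ (i , sym (FP.splitAt⁻¹-↑ʳ eq))

  X≢Y : ∀ j i → X {n} {m} j ≢ Y i
  X≢Y j i Xj≡Yi with trans (sym (FP.splitAt-↑ˡ n j m)) (trans (cong (Fn.splitAt n) Xj≡Yi) (FP.splitAt-↑ʳ n m i))
  ... | ()

  X-injective : ∀ {j j′} → X {n} {m} j ≡ X j′ → j ≡ j′
  X-injective {j} {j′} = FP.↑ˡ-injective m j j′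

  Y-injective : ∀ {i i′} → Y {n} {m} i ≡ Y i′ → i ≡ i′
  Y-injective {i} {i′} = FP.↑ʳ-injective n i i′

  infixr 5 _⊕_
  _⊕_ : Subset n → Subset m → Subset N
  S ⊕ R = S V.++ R

  lookup-⊕-X : ∀ S R j → lookup (S ⊕ R) (X j) ≡ lookup S j
  lookup-⊕-X S R j = VP.lookup-++ˡ S R j

  lookup-⊕-Y : ∀ S R i → lookup (S ⊕ R) (Y i) ≡ lookup R i
  lookup-⊕-Y S R i = VP.lookup-++ʳ S R i

  ⊕-unique : ∀ {U S R} → (∀ j → lookup U (X j) ≡ lookup S j) → (∀ i → lookup U (Y i) ≡ lookup R i) → U ≡ S ⊕ R
  ⊕-unique {U} {S} {R} sameX sameY = vec-ext at
    where
    at : ∀ v → lookup U v ≡ lookup (S ⊕ R) v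
    at v with X-or-Y v
    ... | inj₁ (j , refl) = trans (sameX j) (sym (lookup-⊕-X S R j))
    ... | inj₂ (i , refl) = trans (sameY i) (sym (lookup-⊕-Y S R i))

  Xpart : Subset N → Subset n
  Xpart U = tabulate (λ j → lookup U (X j))

  lookup-Xpart : ∀ U j → lookup (Xpart U) j ≡ lookup U (X j)
  lookup-Xpart U j = VP.lookup∘tabulate _ j

  noY⇒Xpart : ∀ {U} → (∀ i → lookup U (Y i) ≡ false) → U ≡ Xpart U ⊕ Sub.⊥
  noY⇒Xpart {U} noY = ⊕-unique {S = Xpart U} {R = Sub.⊥} (λ j → sym (lookup-Xpart U j)) (λ i → trans (noY i) (sym (lookup-⊥ i)))

  wX : Subset n → List (Fin N)
  wX S = map X (elems S)

  wX-unique : ∀ S → Unique (wX S)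
  wX-unique S = UP.map⁺ X-injective (elems-unique S)

  occurs-wX : ∀ S v → occurs (wX S) v ≡ lookup (S ⊕ Sub.⊥) v
  occurs-wX S v with X-or-Y v
  ... | inj₁ (j , refl) = bool-ext
        (λ occ → X-case (∈-map⁻ X (occurs⇒∈ (wX S) occ)))
        (λ j∈S → ∈⇒occurs (∈-map⁺ X (elems-complete S j (trans (sym (lookup-⊕-X S Sub.⊥ j)) j∈S))))
    where
    X-case : (∃ λ j′ → j′ ∈ˡ elems S × X j ≡ X j′) → lookup (S ⊕ Sub.⊥) (X j) ≡ true
    X-case (j′ , j′∈S , Xj≡Xj′) rewrite X-injective Xj≡Xj′ = trans (lookup-⊕-X S Sub.⊥ j′) (elems-sound S j′∈S)
  ... | inj₂ (i , refl) =
        trans (∉⇒¬occurs (wX S) Yi∉wX) (sym (trans (lookup-⊕-Y S Sub.⊥ i) (lookup-⊥ i)))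
    where
    Yi∉wX : Y i ∉ˡ wX S
    Yi∉wX Yi∈ with ∈-map⁻ X Yi∈
    ... | j , _ , Yi≡Xj = X≢Y j i (sym Yi≡Xj)

  occurs-wX-X : ∀ S j → occurs (wX S) (X j) ≡ lookup S j
  occurs-wX-X S j = trans (occurs-wX S (X j)) (lookup-⊕-X S Sub.⊥ j)

  occurs-wX-Y : ∀ S i → occurs (wX S) (Y i) ≡ false
  occurs-wX-Y S i = trans (occurs-wX S (Y i)) (trans (lookup-⊕-Y S Sub.⊥ i) (lookup-⊥ i))

  monoX-χ : ∀ (S : Subset n) → monoX {n} {m} S ≡ χ (S ⊕ Sub.⊥)
  monoX-χ S = vec-ext (λ v → trans (build (elems S) (elems-unique S) v)
                                     (trans (cong b2n (occurs-wX S v)) (sym (lookup-χ (S ⊕ Sub.⊥) v))))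
    where
    mark : List (Fin n) → Mono N
    mark = foldr (λ j α → updateAt α (X j) suc) (replicate N 0)
    build : ∀ js → Unique js → ∀ v → lookup (mark js) v ≡ b2n (occurs (map X js) v)
    build [] _ v = VP.lookup-replicate v 0
    build (j ∷ js) (j∉js ∷ u) v with X j Fn.≟ v
    ... | yes refl = trans (VP.lookup∘updateAt (X j) (mark js))
           (cong suc (trans (build js u (X j)) (cong b2n (∉⇒¬occurs (map X js) Xj∉))))
      where
      Xj∉ : X j ∉ˡ map X js
      Xj∉ Xj∈ with ∈-map⁻ X Xj∈
      ... | j′ , j′∈js , Xj≡Xj′ = All.lookup j∉js j′∈js (X-injective Xj≡Xj′)
    ... | no Xj≢v = trans (VP.lookup∘updateAt′ v (X j) (Xj≢v ∘ sym) (mark js)) (build js u v)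

  monoYX-χ : ∀ i (S : Subset n) → monoYX {n} {m} i S ≡ χ (S ⊕ ⁅ i ⁆)
  monoYX-χ i S = vec-ext at
    where
    lookup-χ⊕ : ∀ R v → lookup (χ (S ⊕ R)) v ≡ b2n (lookup (S ⊕ R) v)
    lookup-χ⊕ R = lookup-χ (S ⊕ R)
    at : ∀ v → lookup (monoYX {n} {m} i S) v ≡ lookup (χ (S ⊕ ⁅ i ⁆)) v
    at v with X-or-Y v
    ... | inj₁ (j , refl) = begin
      lookup (updateAt (monoX S) (Y i) suc) (X j) ≡⟨ VP.lookup∘updateAt′ (X j) (Y i) (X≢Y j i) (monoX S) ⟩
      lookup (monoX S) (X j)                      ≡⟨ cong (λ α → lookup α (X j)) (monoX-χ S) ⟩
      lookup (χ (S ⊕ Sub.⊥)) (X j)                ≡⟨ lookup-χ⊕ Sub.⊥ (X j) ⟩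
      b2n (lookup (S ⊕ Sub.⊥) (X j))              ≡⟨ cong b2n (trans (lookup-⊕-X S Sub.⊥ j) (sym (lookup-⊕-X S ⁅ i ⁆ j))) ⟩
      b2n (lookup (S ⊕ ⁅ i ⁆) (X j))              ≡⟨ sym (lookup-χ⊕ ⁅ i ⁆ (X j)) ⟩
      lookup (χ (S ⊕ ⁅ i ⁆)) (X j)                ∎
      where open ≡-Reasoning
    ... | inj₂ (i′ , refl) with i′ Fn.≟ i
    ...   | yes refl = begin
      lookup (updateAt (monoX S) (Y i) suc) (Y i) ≡⟨ VP.lookup∘updateAt (Y i) (monoX S) ⟩
      suc (lookup (monoX S) (Y i))                ≡⟨ cong (λ α → suc (lookup α (Y i))) (monoX-χ S) ⟩
      suc (lookup (χ (S ⊕ Sub.⊥)) (Y i))          ≡⟨ cong suc (trans (lookup-χ⊕ Sub.⊥ (Y i))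
                                                       (cong b2n (trans (lookup-⊕-Y S Sub.⊥ i) (lookup-⊥ i)))) ⟩
      1                                           ≡⟨ sym (trans (lookup-χ⊕ ⁅ i ⁆ (Y i))
                                                       (cong b2n (trans (lookup-⊕-Y S ⁅ i ⁆ i) (lookup-⁅⁆ i)))) ⟩
      lookup (χ (S ⊕ ⁅ i ⁆)) (Y i)                ∎
      where open ≡-Reasoning
    ...   | no i′≢i = begin
      lookup (updateAt (monoX S) (Y i) suc) (Y i′) ≡⟨ VP.lookup∘updateAt′ (Y i′) (Y i) (i′≢i ∘ Y-injective) (monoX S) ⟩
      lookup (monoX S) (Y i′)                      ≡⟨ cong (λ α → lookup α (Y i′)) (monoX-χ S) ⟩
      lookup (χ (S ⊕ Sub.⊥)) (Y i′)                ≡⟨ trans (lookup-χ⊕ Sub.⊥ (Y i′))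
                                                        (cong b2n (trans (lookup-⊕-Y S Sub.⊥ i′) (lookup-⊥ i′))) ⟩
      0                                            ≡⟨ sym (trans (lookup-χ⊕ ⁅ i ⁆ (Y i′))
                                                        (cong b2n (trans (lookup-⊕-Y S ⁅ i ⁆ i′) (lookup-⁅⁆-≢ i i′ i′≢i)))) ⟩
      lookup (χ (S ⊕ ⁅ i ⁆)) (Y i′)                ∎
      where open ≡-Reasoning

module Generated {n m : ℕ} (F : Fin m → Subset n) where

  open Variables n m

  supp : Fin m → Subset N
  supp i = F i ⊕ ⁅ i ⁆

  lookup-supp-X : ∀ i j → lookup (supp i) (X j) ≡ lookup (F i) j
  lookup-supp-X i j = lookup-⊕-X (F i) ⁅ i ⁆ j

  lookup-supp-Y : ∀ i → lookup (supp i) (Y i) ≡ true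
  lookup-supp-Y i = trans (lookup-⊕-Y (F i) ⁅ i ⁆ i) (lookup-⁅⁆ i)

  lookup-supp-Y≢ : ∀ i i′ → i′ ≢ i → lookup (supp i) (Y i′) ≡ false
  lookup-supp-Y≢ i i′ i′≢i = trans (lookup-⊕-Y (F i) ⁅ i ⁆ i′) (lookup-⁅⁆-≢ i i′ i′≢i)

  f : Poly N
  f = fPoly F

  f-χ : f ≡ map (λ i → (1ℚ , χ (supp i))) (allFin m)
  f-χ = LP.map-cong (λ i → cong (1ℚ ,_) (monoYX-χ i (F i))) (allFin m)

  term : List (Fin N) → Fin m → Poly N
  term w i = if fits (supp i) w then (1ℚ , χ (remove (supp i) w)) ∷ [] else []

  ∂w-f : ∀ w → ∂w w f ≡ concatMap (term w) (allFin m)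
  ∂w-f w = begin
    ∂w w f                                                        ≡⟨ cong (∂w w) f-χ ⟩
    ∂w w (map (λ i → (1ℚ , χ (supp i))) (allFin m))               ≡⟨ ∂w-map w _ (allFin m) ⟩
    concatMap (λ i → ∂w w ((1ℚ , χ (supp i)) ∷ [])) (allFin m)   ≡⟨ LP.concatMap-cong (λ i → ∂w-χ w 1ℚ (supp i)) (allFin m) ⟩
    concatMap (term w) (allFin m)                                 ∎
    where open ≡-Reasoning

  coeff-∂w-f : ∀ w α → coeff (∂w w f) α ≡ sumℚ (map (λ i → coeff (term w i) α) (allFin m))
  coeff-∂w-f w α = trans (cong (λ p → coeff p α) (∂w-f w)) (coeff-concatMap (term w) (allFin m) α)

  term-fits : ∀ w i → fits (supp i) w ≡ true → term w i ≡ (1ℚ , χ (remove (supp i) w)) ∷ []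
  term-fits w i ok rewrite ok = refl

  term-¬fits : ∀ w i → fits (supp i) w ≡ false → term w i ≡ []
  term-¬fits w i ¬ok rewrite ¬ok = refl

  coeff-term-0 : ∀ w i α → (fits (supp i) w ≡ true → χ (remove (supp i) w) ≢ α) → coeff (term w i) α ≡ 0ℚ
  coeff-term-0 w i α differs with fits (supp i) w
  ... | true = coeff-single-≢ 1ℚ (differs refl)
  ... | false = refl

  Y∈remove : ∀ w i → occurs w (Y i) ≡ false → lookup (remove (supp i) w) (Y i) ≡ true
  Y∈remove w i ¬occ = trans (lookup-remove (supp i) w (Y i)) (cong₂ (λ a b → a ∧ not b) (lookup-supp-Y i) ¬occ)

  Y∉remove : ∀ w i i′ → i′ ≢ i → lookup (remove (supp i′) w) (Y i) ≡ false
  Y∉remove w i i′ i′≢i = trans (lookup-remove (supp i′) w (Y i))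
    (cong (λ a → a ∧ not (occurs w (Y i))) (lookup-supp-Y≢ i′ i (i′≢i ∘ sym)))

  coeff-term-Y : ∀ w i i′ (U : Subset N) → i′ ≢ i → lookup U (Y i) ≡ true → coeff (term w i′) (χ U) ≡ 0ℚ
  coeff-term-Y w i i′ U i′≢i Yi∈U = coeff-term-0 w i′ (χ U) λ _ same →
    contradiction (trans (sym (Y∉remove w i i′ i′≢i)) (trans (χ-injective same (Y i)) Yi∈U)) (λ ())

  noY-throughY : ∀ w i → occurs w (Y i) ≡ true → ∀ i′ → lookup (remove (supp i) w) (Y i′) ≡ false
  noY-throughY w i Yi∈w i′ with i′ Fn.≟ i
  ... | yes refl = remove-occurs (supp i) w Yi∈w
  ... | no i′≢i = Y∉remove w i′ i (i′≢i ∘ sym)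

  -- If w fits supp i and uses Y_i, then ∂_w f is the pure X-monomial x^{supp i ∖ w}:
  -- every other term contains no Y_i and is killed.
  ∂w-f-throughY : ∀ w i → fits (supp i) w ≡ true → occurs w (Y i) ≡ true →
    ∂w w f ≈ monoP (Xpart (remove (supp i) w))
  ∂w-f-throughY w i ok Yi∈w α = begin
    coeff (∂w w f) α                                      ≡⟨ coeff-∂w-f w α ⟩
    sumℚ (map (λ i′ → coeff (term w i′) α) (allFin m))    ≡⟨ sumℚ-single _ (allFin m) i (UP.allFin⁺ m) (∈-allFin i) others ⟩
    coeff (term w i) α                                    ≡⟨ cong (λ p → coeff p α) (term-fits w i ok) ⟩
    coeff ((1ℚ , χ (remove (supp i) w)) ∷ []) α           ≡⟨ cong (λ β → coeff ((1ℚ , β) ∷ []) α) monomial ⟩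
    coeff (monoP (Xpart (remove (supp i) w))) α           ∎
    where
    open ≡-Reasoning
    others : ∀ i′ → i′ ≢ i → coeff (term w i′) α ≡ 0ℚ
    others i′ i′≢i = cong (λ p → coeff p α)
      (term-¬fits w i′ (fits-false (supp i′) w (occurs⇒∈ w Yi∈w) (lookup-supp-Y≢ i′ i (i′≢i ∘ sym))))
    monomial : χ (remove (supp i) w) ≡ monoX (Xpart (remove (supp i) w))
    monomial = trans (cong χ (noY⇒Xpart (noY-throughY w i Yi∈w))) (sym (monoX-χ _))

  coeff-∂w-f-avoidY : ∀ w i → fits (supp i) w ≡ true → occurs w (Y i) ≡ false →
    coeff (∂w w f) (χ (remove (supp i) w)) ≡ 1ℚ
  coeff-∂w-f-avoidY w i ok ¬occ = begin
    coeff (∂w w f) α                                      ≡⟨ coeff-∂w-f w α ⟩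
    sumℚ (map (λ i′ → coeff (term w i′) α) (allFin m))    ≡⟨ sumℚ-single _ (allFin m) i (UP.allFin⁺ m) (∈-allFin i) others ⟩
    coeff (term w i) α                                    ≡⟨ cong (λ p → coeff p α) (term-fits w i ok) ⟩
    coeff ((1ℚ , α) ∷ []) α                               ≡⟨ coeff-single-≡ 1ℚ {α} refl ⟩
    1ℚ                                                    ∎
    where
    open ≡-Reasoning
    α : Mono N
    α = χ (remove (supp i) w)
    others : ∀ i′ → i′ ≢ i → coeff (term w i′) α ≡ 0ℚ
    others i′ i′≢i = coeff-term-Y w i i′ (remove (supp i) w) i′≢i (Y∈remove w i ¬occ)

  ∂w-f-sameLetters : ∀ {w w′} → Unique w → Unique w′ → (∀ v → occurs w v ≡ occurs w′ v) → ∂w w f ≡ ∂w w′ f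
  ∂w-f-sameLetters {w} {w′} u u′ same = begin
    ∂w w f                           ≡⟨ ∂w-f w ⟩
    concatMap (term w) (allFin m)    ≡⟨ LP.concatMap-cong same-term (allFin m) ⟩
    concatMap (term w′) (allFin m)   ≡⟨ sym (∂w-f w′) ⟩
    ∂w w′ f                          ∎
    where
    open ≡-Reasoning
    same-term : ∀ i → term w i ≡ term w′ i
    same-term i = cong₂ (λ b U → if b then (1ℚ , χ U) ∷ [] else [])
      (fits-sameLetters (supp i) u u′ same) (remove-sameLetters (supp i) {w} {w′} same)

  faces-unique : Unique (faces F)
  faces-unique = UP.filter⁺ (isFace? F) (allSubsets-unique n)

  face⇒∈faces : ∀ {S} → IsFace F S → S ∈ˡ faces F
  face⇒∈faces {S} face = ∈-filter⁺ (isFace? F) (allSubsets-complete S) face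

  ∈faces⇒face : ∀ {S} → S ∈ˡ faces F → IsFace F S
  ∈faces⇒face S∈ = proj₂ (∈-filter⁻ (isFace? F) {xs = allSubsets n} S∈)

  fits-wX : ∀ S i → S ⊆ F i → fits (supp i) (wX S) ≡ true
  fits-wX S i S⊆Fi = fits-intro (supp i) (wX S) (wX-unique S) inside
    where
    inside : ∀ {v} → v ∈ˡ wX S → lookup (supp i) v ≡ true
    inside v∈ with ∈-map⁻ X v∈
    ... | j , j∈S , refl = trans (lookup-supp-X i j) (⊆⇒lookup S⊆Fi j (elems-sound S j∈S))

  fits-wX⁻ : ∀ S i → fits (supp i) (wX S) ≡ true → S ⊆ F i
  fits-wX⁻ S i ok = lookup⇒⊆ λ j j∈S →
    trans (sym (lookup-supp-X i j)) (fits⇒⊆ (supp i) (wX S) ok (∈-map⁺ X (elems-complete S j j∈S)))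

  remove-wX-X : ∀ i S j → lookup (remove (supp i) (wX S)) (X j) ≡ lookup (F i) j ∧ not (lookup S j)
  remove-wX-X i S j = trans (lookup-remove (supp i) (wX S) (X j))
    (cong₂ (λ a b → a ∧ not b) (lookup-supp-X i j) (occurs-wX-X S j))

  remove-wX-Y : ∀ i S → lookup (remove (supp i) (wX S)) (Y i) ≡ true
  remove-wX-Y i S = Y∈remove (wX S) i (occurs-wX-Y S i)

  remove-wX-injective : ∀ i {S′ S} → S′ ⊆ F i → S ⊆ F i →
    χ (remove (supp i) (wX S′)) ≡ χ (remove (supp i) (wX S)) → S′ ≡ S
  remove-wX-injective i {S′} {S} S′⊆Fi S⊆Fi same = vec-ext λ j →
    ∧not-cancel (lookup (F i) j) (lookup S′ j) (lookup S j) (⊆⇒lookup S′⊆Fi j) (⊆⇒lookup S⊆Fi j)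
      (trans (sym (remove-wX-X i S′ j)) (trans (χ-injective same (X j)) (remove-wX-X i S j)))

  -- The word Y_i · ∂/∂(F_i ∖ S): for S ⊆ F_i it removes from supp i all but S.
  complementIn : Fin m → Subset n → Subset n
  complementIn i S = tabulate (λ j → lookup (F i) j ∧ not (lookup S j))

  wY : Fin m → Subset n → List (Fin N)
  wY i S = Y i ∷ wX (complementIn i S)

  occurs-wY : ∀ i S → occurs (wY i S) (Y i) ≡ true
  occurs-wY i S = cong (_∨ occurs (wX (complementIn i S)) (Y i)) (dec-true (Y {n} {m} i Fn.≟ Y i) refl)

  fits-wY : ∀ i S → fits (supp i) (wY i S) ≡ true
  fits-wY i S = fits-intro (supp i) (wY i S) (Yi∉wX ∷ wX-unique _) inside
    where
    Yi∉wX : All (Y i ≢_) (wX (complementIn i S))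
    Yi∉wX = All.tabulate λ {v} v∈ Yi≡v →
      contradiction (trans (sym (∈⇒occurs (subst (_∈ˡ wX (complementIn i S)) (sym Yi≡v) v∈))) (occurs-wX-Y _ i)) (λ ())
    inside : ∀ {v} → v ∈ˡ wY i S → lookup (supp i) v ≡ true
    inside (here refl) = lookup-supp-Y i
    inside (there v∈) with ∈-map⁻ X v∈
    ... | j , j∈ , refl = trans (lookup-supp-X i j)
      (proj₁ (∧-true (trans (sym (VP.lookup∘tabulate _ j)) (elems-sound _ j∈))))

  Xpart-remove-wY : ∀ i S → S ⊆ F i → Xpart (remove (supp i) (wY i S)) ≡ S
  Xpart-remove-wY i S S⊆Fi = vec-ext λ j → begin
    lookup (Xpart (remove (supp i) (wY i S))) j
      ≡⟨ trans (lookup-Xpart (remove (supp i) (wY i S)) j) (lookup-remove (supp i) (wY i S) (X j)) ⟩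
    lookup (supp i) (X j) ∧ not (does (Y i Fn.≟ X j) ∨ occurs (wX _) (X j))
      ≡⟨ cong₂ (λ a b → a ∧ not b) (lookup-supp-X i j)
               (cong₂ _∨_ (dec-false (Y i Fn.≟ X j) (X≢Y j i ∘ sym))
                          (trans (occurs-wX-X _ j) (VP.lookup∘tabulate _ j))) ⟩
    lookup (F i) j ∧ not (lookup (F i) j ∧ not (lookup S j))
      ≡⟨ ∧-not-∧-not (lookup (F i) j) (lookup S j) (⊆⇒lookup S⊆Fi j) ⟩
    lookup S j ∎
    where open ≡-Reasoning

  monoX-injective : ∀ {S′ S : Subset n} → monoX {n} {m} S′ ≡ monoX S → S′ ≡ S
  monoX-injective {S′} {S} same = vec-ext λ j →
    trans (sym (lookup-⊕-X S′ Sub.⊥ j))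
      (trans (χ-injective (trans (sym (monoX-χ S′)) (trans same (monoX-χ S))) (X j)) (lookup-⊕-X S Sub.⊥ j))

  monoX-noY : ∀ (S : Subset n) (U : Subset N) i → lookup U (Y i) ≡ true → monoX {n} {m} S ≢ χ U
  monoX-noY S U i Yi∈U same = contradiction
    (trans (sym (trans (lookup-⊕-Y S Sub.⊥ i) (lookup-⊥ i))) (trans (χ-injective (trans (sym (monoX-χ S)) same) (Y i)) Yi∈U))
    (λ ())

  -- Index the basis by Subset n ⊎ Subset n (inj₁: monomials,
  -- inj₂: derivatives).  Its dual test monomials are X^S for ∏_{j∈S} X_j, and
  -- Y_i X^{F_i ∖ S} for ∂f/∂S, with i any index such that S ⊆ F_i.

  family : Subset n ⊎ Subset n → Poly N
  family (inj₁ S) = monoP S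
  family (inj₂ S) = ∂F F S

  indices : List (Subset n ⊎ Subset n)
  indices = map inj₁ (faces F) ++ map inj₂ (faces F)

  basis-family : map family indices ≡ basis F
  basis-family = begin
    map family (map inj₁ (faces F) ++ map inj₂ (faces F))
      ≡⟨ LP.map-++ family (map inj₁ (faces F)) (map inj₂ (faces F)) ⟩
    map family (map inj₁ (faces F)) ++ map family (map inj₂ (faces F))
      ≡⟨ cong₂ _++_ (sym (LP.map-∘ (faces F))) (sym (LP.map-∘ (faces F))) ⟩
    basis F ∎
    where open ≡-Reasoning

  indices-unique : Unique indices
  indices-unique = UP.++⁺ (UP.map⁺ inj₁-injective faces-unique) (UP.map⁺ inj₂-injective faces-unique) disjoint
    where
    inj₁-injective : ∀ {S S′ : Subset n} → inj₁ {B = Subset n} S ≡ inj₁ S′ → S ≡ S′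
    inj₁-injective refl = refl
    inj₂-injective : ∀ {S S′ : Subset n} → inj₂ {A = Subset n} S ≡ inj₂ S′ → S ≡ S′
    inj₂-injective refl = refl
    disjoint : ∀ {x} → ¬ (x ∈ˡ map inj₁ (faces F) × x ∈ˡ map inj₂ (faces F))
    disjoint (x∈₁ , x∈₂) with ∈-map⁻ inj₁ x∈₁ | ∈-map⁻ inj₂ x∈₂
    ... | _ , _ , refl | _ , _ , ()

  inj₂∈indices⇒face : ∀ {S} → inj₂ S ∈ˡ indices → IsFace F S
  inj₂∈indices⇒face {S} S∈ with ∈-++⁻ (map inj₁ (faces F)) S∈
  ... | inj₁ S∈₁ with ∈-map⁻ inj₁ S∈₁
  ...   | _ , _ , ()
  inj₂∈indices⇒face {S} S∈ | inj₂ S∈₂ with ∈-map⁻ inj₂ S∈₂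
  ...   | _ , S∈faces , refl = ∈faces⇒face S∈faces

  dualMono : Subset n → Mono N
  dualMono S with isFace? F S
  ... | yes (_ , i , _) = χ (remove (supp i) (wX S))
  ... | no _ = monoX S

  test : Subset n ⊎ Subset n → Mono N
  test (inj₁ S) = monoX S
  test (inj₂ S) = dualMono S

  monoP-at-monoX : ∀ S′ S → S′ ≢ S → coeff (monoP {n} {m} S′) (monoX S) ≡ 0ℚ
  monoP-at-monoX S′ S S′≢S = coeff-single-≢ 1ℚ (S′≢S ∘ monoX-injective)

  ∂F-at-monoX : ∀ S′ S → coeff (∂F F S′) (monoX S) ≡ 0ℚ
  ∂F-at-monoX S′ S = trans (coeff-∂w-f (wX S′) (monoX S)) (sumℚ-vanish _ (allFin m) λ {i} _ →
    coeff-term-0 (wX S′) i (monoX S) λ _ same →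
      monoX-noY S (remove (supp i) (wX S′)) i (remove-wX-Y i S′) (sym same))

  monoP-at-dual : ∀ S′ S → IsFace F S → coeff (monoP {n} {m} S′) (dualMono S) ≡ 0ℚ
  monoP-at-dual S′ S face with isFace? F S
  ... | yes (_ , i , _) = coeff-single-≢ 1ℚ (monoX-noY S′ (remove (supp i) (wX S)) i (remove-wX-Y i S))
  ... | no ¬face = contradiction face ¬face

  ∂F-at-dual : ∀ S → IsFace F S → coeff (∂F F S) (dualMono S) ≡ 1ℚ
  ∂F-at-dual S face with isFace? F S
  ... | yes (_ , i , S⊆Fi) = coeff-∂w-f-avoidY (wX S) i (fits-wX S i S⊆Fi) (occurs-wX-Y S i)
  ... | no ¬face = contradiction face ¬face

  ∂F-at-dual-≢ : ∀ S′ S → IsFace F S → S′ ≢ S → coeff (∂F F S′) (dualMono S) ≡ 0ℚ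
  ∂F-at-dual-≢ S′ S face S′≢S with isFace? F S
  ... | no ¬face = contradiction face ¬face
  ... | yes (_ , i , S⊆Fi) = trans (coeff-∂w-f (wX S′) α) (sumℚ-vanish _ (allFin m) λ {i′} _ → at i′)
    where
    α : Mono N
    α = χ (remove (supp i) (wX S))
    at : ∀ i′ → coeff (term (wX S′) i′) α ≡ 0ℚ
    at i′ with i′ Fn.≟ i
    ... | no i′≢i = coeff-term-Y (wX S′) i i′ (remove (supp i) (wX S)) i′≢i (remove-wX-Y i S)
    ... | yes refl = coeff-term-0 (wX S′) i α λ ok same →
            S′≢S (remove-wX-injective i (fits-wX⁻ S′ i ok) S⊆Fi same)

  basis-independent : LinIndep (basis F)
  basis-independent = subst LinIndep basis-family
    (diagonal-indep indices indices-unique family test diag off)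
    where
    diag : ∀ {x} → x ∈ˡ indices → coeff (family x) (test x) ≡ 1ℚ
    diag {inj₁ S} _ = coeff-single-≡ 1ℚ {monoX S} refl
    diag {inj₂ S} x∈ = ∂F-at-dual S (inj₂∈indices⇒face x∈)
    off : ∀ {x y} → x ∈ˡ indices → y ∈ˡ indices → x ≢ y → coeff (family x) (test y) ≡ 0ℚ
    off {inj₁ S′} {inj₁ S} _ _ x≢y = monoP-at-monoX S′ S (x≢y ∘ cong inj₁)
    off {inj₂ S′} {inj₁ S} _ _ _ = ∂F-at-monoX S′ S
    off {inj₁ S′} {inj₂ S} _ y∈ _ = monoP-at-dual S′ S (inj₂∈indices⇒face y∈)
    off {inj₂ S′} {inj₂ S} _ y∈ x≢y = ∂F-at-dual-≢ S′ S (inj₂∈indices⇒face y∈) (x≢y ∘ cong inj₂)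

  basis-length : length (basis F) ≡ 2 * ∣Δ∣ F
  basis-length = begin
    length (map monoP (faces F) ++ map (∂F F) (faces F))
      ≡⟨ LP.length-++ (map monoP (faces F)) ⟩
    length (map monoP (faces F)) ℕ.+ length (map (∂F F) (faces F))
      ≡⟨ cong₂ ℕ._+_ (LP.length-map monoP (faces F)) (LP.length-map (∂F F) (faces F)) ⟩
    ∣Δ∣ F ℕ.+ ∣Δ∣ F
      ≡⟨ cong (∣Δ∣ F ℕ.+_) (sym (NP.+-identityʳ (∣Δ∣ F))) ⟩
    2 * ∣Δ∣ F ∎
    where open ≡-Reasoning

  module Uniform (d : ℕ) (∣F∣≡d : ∀ i → ∣ F i ∣ ≡ d) where

    -- Every term of f has degree d + 1 and coefficient 1, so deg f = d + 1 when m ≥ 1.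
    ∣supp∣ : ∀ i → ∣ supp i ∣ ≡ suc d
    ∣supp∣ i = begin
      ∣ F i ⊕ ⁅ i ⁆ ∣         ≡⟨ ∣⊕∣ (F i) ⁅ i ⁆ ⟩
      ∣ F i ∣ ℕ.+ ∣ ⁅ i ⁆ ∣   ≡⟨ cong₂ ℕ._+_ (∣F∣≡d i) (SubP.∣⁅x⁆∣≡1 i) ⟩
      d ℕ.+ 1                 ≡⟨ NP.+-comm d 1 ⟩
      suc d                   ∎
      where open ≡-Reasoning

    deg-f-≤ : deg f ≤ suc d
    deg-f-≤ = deg-≤ f (suc d) bound
      where
      bound : ∀ {t} → t ∈ˡ f → totDeg (proj₂ t) ≤ suc d
      bound t∈f with ∈-map⁻ (λ i → (1ℚ , χ (supp i))) (subst (_ ∈ˡ_) f-χ t∈f)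
      ... | i , _ , refl = NP.≤-reflexive (trans (totDeg-χ (supp i)) (∣supp∣ i))

    coeff-f : ∀ i → coeff f (χ (supp i)) ≡ 1ℚ
    coeff-f i = subst (λ T → coeff f (χ T) ≡ 1ℚ) (remove-[] (supp i)) (coeff-∂w-f-avoidY [] i refl refl)

    deg-f-≥ : Fin m → suc d ≤ deg f
    deg-f-≥ i = subst (_≤ deg f) (trans (totDeg-χ (supp i)) (∣supp∣ i))
      (deg-≥ f (subst ((1ℚ , χ (supp i)) ∈ˡ_) (sym f-χ) (∈-map⁺ (λ i → (1ℚ , χ (supp i))) (∈-allFin i)))
        (λ c≡0 → contradiction (trans (sym (coeff-f i)) c≡0) (λ ())))

    fitting-length : ∀ i w → fits (supp i) w ≡ true → ∀ v → lookup (remove (supp i) w) v ≡ true → length w ≤ d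
    fitting-length i w ok v v∈ = NP.+-cancelˡ-≤ 1 _ _ (begin
      1 ℕ.+ length w                        ≤⟨ NP.+-monoˡ-≤ (length w) (∣∣-pos (remove (supp i) w) v v∈) ⟩
      ∣ remove (supp i) w ∣ ℕ.+ length w    ≡⟨ ∣remove∣ (supp i) w ok ⟩
      ∣ supp i ∣                            ≡⟨ ∣supp∣ i ⟩
      1 ℕ.+ d                               ∎)
      where open NP.≤-Reasoning

    short-word-leaves-rest : ∀ i w → fits (supp i) w ≡ true → length w ≤ d → 1 ≤ ∣ remove (supp i) w ∣
    short-word-leaves-rest i w ok |w|≤d = NP.+-cancelʳ-≤ (length w) 1 _ (begin
      suc (length w)                       ≤⟨ s≤s |w|≤d ⟩
      suc d                                ≡⟨ sym (∣supp∣ i) ⟩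
      ∣ supp i ∣                           ≡⟨ sym (∣remove∣ (supp i) w ok) ⟩
      ∣ remove (supp i) w ∣ ℕ.+ length w   ∎)
      where open NP.≤-Reasoning

    order-≤ : ∀ {r} → r ≤ deg f ∸ 1 → r ≤ d
    order-≤ r≤ = NP.≤-trans r≤ (NP.∸-monoˡ-≤ 1 deg-f-≤)

    order-≥ : ∀ {r} → Fin m → r ≤ d → r ≤ deg f ∸ 1
    order-≥ i r≤d = NP.≤-trans r≤d (NP.∸-monoˡ-≤ 1 (deg-f-≥ i))

    derivative∈∂⁺ : ∀ w i → 1 ≤ length w → length w ≤ d → In∂⁺ f (∂w w f)
    derivative∈∂⁺ w i 1≤|w| |w|≤d =
      (1ℚ , w) ∷ [] , (1≤|w| , order-≥ i |w|≤d) ∷ [] , λ α → sym (lincomb-single (∂w w f) α)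

    -- ∂f/∂S is a derivative of order |S| ≥ 1; the Y_i survive, so |S| ≤ d.
    ∂F∈∂⁺ : ∀ S → IsFace F S → In∂⁺ f (∂F F S)
    ∂F∈∂⁺ S ((j , j∈S) , i , S⊆Fi) = derivative∈∂⁺ (wX S) i
      (∈⇒1≤length (∈-map⁺ X (elems-complete S j (VP.[]=⇒lookup j∈S))))
      (fitting-length i (wX S) (fits-wX S i S⊆Fi) (Y i) (remove-wX-Y i S))

    -- ∏_{j∈S} X_j = ∂_w f for the word w = Y_i · ∂/∂(F_i ∖ S): only the i-th
    -- term involves Y_i, and it loses Y_i and the X_j with j ∈ F_i ∖ S.
    monoP∈∂⁺ : ∀ S → IsFace F S → In∂⁺ f (monoP S)
    monoP∈∂⁺ S ((j , j∈S) , i , S⊆Fi) = ∂⁺-≈ f {monoP S} {∂w (wY i S) f} monoP≈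
      (derivative∈∂⁺ (wY i S) i (s≤s z≤n) (fitting-length i (wY i S) (fits-wY i S) (X j) Xj-left))
      where
      left : Xpart (remove (supp i) (wY i S)) ≡ S
      left = Xpart-remove-wY i S S⊆Fi
      monoP≈ : monoP S ≈ ∂w (wY i S) f
      monoP≈ α = sym (trans (∂w-f-throughY (wY i S) i (fits-wY i S) (occurs-wY i S) α)
                            (cong (λ T → coeff (monoP T) α) left))
      Xj-left : lookup (remove (supp i) (wY i S)) (X j) ≡ true
      Xj-left = trans (sym (lookup-Xpart (remove (supp i) (wY i S)) j)) (trans (cong (λ T → lookup T j) left) (VP.[]=⇒lookup j∈S))

    monoP∈basis : ∀ {S} → IsFace F S → monoP S ∈ˡ basis F
    monoP∈basis face = ∈-++⁺ˡ (∈-map⁺ monoP (face⇒∈faces face))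

    ∂F∈basis : ∀ {S} → IsFace F S → ∂F F S ∈ˡ basis F
    ∂F∈basis face = ∈-++⁺ʳ (map monoP (faces F)) (∈-map⁺ (∂F F) (face⇒∈faces face))

    basis⊆∂⁺ : All (In∂⁺ f) (basis F)
    basis⊆∂⁺ = AllP.++⁺ (AllP.map⁺ (All.tabulate (λ S∈ → monoP∈∂⁺ _ (∈faces⇒face S∈))))
                        (AllP.map⁺ (All.tabulate (λ S∈ → ∂F∈∂⁺ _ (∈faces⇒face S∈))))

    derivative-throughY : ∀ w i → fits (supp i) w ≡ true → occurs w (Y i) ≡ true → length w ≤ d →
      ∃[ S ] IsFace F S × ∂w w f ≈ monoP S
    derivative-throughY w i ok Yi∈w |w|≤d = S , (S-nonempty , i , S⊆Fi) , ∂w-f-throughY w i ok Yi∈w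
      where
      S : Subset n
      S = Xpart (remove (supp i) w)
      1≤∣S∣ : 1 ≤ ∣ S ∣
      1≤∣S∣ = begin
        1                                  ≤⟨ short-word-leaves-rest i w ok |w|≤d ⟩
        ∣ remove (supp i) w ∣              ≡⟨ cong ∣_∣ (noY⇒Xpart {remove (supp i) w} (noY-throughY w i Yi∈w)) ⟩
        ∣ S ⊕ Sub.⊥ ∣                      ≡⟨ ∣⊕∣ S (Sub.⊥ {m}) ⟩
        ∣ S ∣ ℕ.+ ∣ Sub.⊥ {m} ∣            ≡⟨ cong (∣ S ∣ ℕ.+_) (SubP.∣⊥∣≡0 m) ⟩
        ∣ S ∣ ℕ.+ 0                        ≡⟨ NP.+-identityʳ _ ⟩
        ∣ S ∣                              ∎
        where open NP.≤-Reasoning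
      S-nonempty : Nonempty S
      S-nonempty with ∣∣-pos⁻ S 1≤∣S∣
      ... | j , j∈S = j , VP.lookup⇒[]= j S j∈S
      S⊆Fi : S ⊆ F i
      S⊆Fi = lookup⇒⊆ λ j j∈S → trans (sym (lookup-supp-X i j))
        (proj₁ (∧-true (trans (sym (lookup-remove (supp i) w (X j))) (trans (sym (lookup-Xpart (remove (supp i) w) j)) j∈S))))

    derivative-avoidY : ∀ w i → fits (supp i) w ≡ true → occurs w (Y i) ≡ false → 1 ≤ length w →
      ∃[ S ] IsFace F S × ∂w w f ≡ ∂F F S
    derivative-avoidY w i ok Yi∉w 1≤|w| = S , (S-nonempty , i , S⊆Fi) , ∂w-f-sameLetters w-unique (wX-unique S) same
      where
      noY : ∀ i′ → occurs w (Y i′) ≡ false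
      noY i′ with i′ Fn.≟ i
      ... | yes refl = Yi∉w
      ... | no i′≢i = BP.¬-not λ occ →
        contradiction (trans (sym (fits⇒⊆ (supp i) w ok (occurs⇒∈ w occ))) (lookup-supp-Y≢ i i′ i′≢i)) (λ ())
      S : Subset n
      S = tabulate (λ j → occurs w (X j))
      same : ∀ v → occurs w v ≡ occurs (wX S) v
      same v with X-or-Y v
      ... | inj₁ (j , refl) = sym (trans (occurs-wX-X S j) (VP.lookup∘tabulate _ j))
      ... | inj₂ (i′ , refl) = trans (noY i′) (sym (occurs-wX-Y S i′))
      w-unique : Unique w
      w-unique = fits⇒unique (supp i) w ok
      S-nonempty : Nonempty S
      S-nonempty with 1≤length⇒∈ w 1≤|w|
      ... | v , v∈w with X-or-Y v
      ...   | inj₁ (j , refl) = j , VP.lookup⇒[]= j S (trans (VP.lookup∘tabulate _ j) (∈⇒occurs v∈w))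
      ...   | inj₂ (i′ , refl) = contradiction (trans (sym (∈⇒occurs v∈w)) (noY i′)) (λ ())
      S⊆Fi : S ⊆ F i
      S⊆Fi = lookup⇒⊆ λ j j∈S → trans (sym (lookup-supp-X i j))
        (fits⇒⊆ (supp i) w ok (occurs⇒∈ w (trans (sym (VP.lookup∘tabulate _ j)) j∈S)))

    fitting-derivative∈span : ∀ w i → fits (supp i) w ≡ true → 1 ≤ length w → length w ≤ d →
      InSpan (basis F) (∂w w f)
    fitting-derivative∈span w i ok 1≤|w| |w|≤d with occurs w (Y i) in Yi∈w
    ... | true with derivative-throughY w i ok Yi∈w |w|≤d
    ...   | S , face , ∂w-f≈ =
      span-≈ (basis F) {∂w w f} {monoP S} ∂w-f≈ (span-elem (basis F) (monoP∈basis face))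
    fitting-derivative∈span w i ok 1≤|w| |w|≤d | false with derivative-avoidY w i ok Yi∈w 1≤|w|
    ...   | S , face , ∂w-f≡ =
      span-≈ (basis F) {∂w w f} {∂F F S} (λ α → cong (λ p → coeff p α) ∂w-f≡) (span-elem (basis F) (∂F∈basis face))

    derivative-vanishes : ∀ w → (∀ i → fits (supp i) w ≡ false) → ∂w w f ≈ zeroP
    derivative-vanishes w none α = trans (coeff-∂w-f w α) (sumℚ-vanish _ (allFin m) λ {i} _ →
      cong (λ p → coeff p α) (term-¬fits w i (none i)))

    derivative∈span : ∀ w → 1 ≤ length w → length w ≤ d → InSpan (basis F) (∂w w f)
    derivative∈span w 1≤|w| |w|≤d with FP.any? (λ i → fits (supp i) w BP.≟ true)
    ... | yes (i , ok) = fitting-derivative∈span w i ok 1≤|w| |w|≤d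
    ... | no none = span-zero (basis F) {∂w w f} (derivative-vanishes w λ i → BP.¬-not (λ ok → none (i , ok)))

    ∂⁺⊆span : ∀ p → In∂⁺ f p → InSpan (basis F) p
    ∂⁺⊆span p (ts , orders , p≈) = span-≈ (basis F) {p} {lincomb (map (λ t → (proj₁ t , ∂w (proj₂ t) f)) ts)} p≈
      (span-lincomb (basis F) (λ t → (proj₁ t , ∂w (proj₂ t) f)) ts
        (All.map (λ {t} (1≤r , r≤) → derivative∈span (proj₂ t) 1≤r (order-≤ r≤)) orders))

lemma6 : (n m d : ℕ) (F : Fin m → Subset n) → (∀ i → ∣ F i ∣ ≡ d) →
    IsBasis∂⁺ (fPoly F) (basis F) × length (basis F) ≡ 2 * ∣Δ∣ F
lemma6 n m d F ∣F∣≡d = (basis⊆∂⁺ , ∂⁺⊆span , basis-independent) , basis-length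
  where
  open Generated F
  open Uniform d ∣F∣≡d
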